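{- Let $p$ be an odd prime and let $H$ be a subgroup of $N_{\rm ns}(p)$ of index $d\geq 2$ containing $H(p)=N_{\rm ns}(p)\cap N_{\rm sp}(p)$. Then the modular curve $X_H$ has a cusp which is not at infinity.
   Context: $X(p)$ is the compactified modular curve over $\mathbb{Q}$ classifying $(E,(P,Q))$ with $(P,Q)$ an $\mathbb{F}_p$-basis of $E[p]$; $X_H=H\backslash X(p)$. Fix a generator $\epsilon_p$ of $\mathbb{F}_p^\times$; $C_{\rm ns}(p)=\left\{\begin{pmatrix}a&\epsilon_p b\\ b&a\end{pmatrix}:(a,b)\neq(0,0)\right\}$, $N_{\rm ns}(p)=C_{\rm ns}(p)\cup\mathrm{diag}(1,-1)C_{\rm ns}(p)$; $N_{\rm sp}(p)$ is the group of diagonal and anti-diagonal invertible matrices. Let $M_p=\big((\mathbb{Z}/p\mathbb{Z})^2\setminus\{0\}\big)/\pm1$. The cusps of $X(p)$ are in $\mathrm{GL}_2(\mathbb{F}_p)$-equivariant bijection with $M_p\times\mathbb{F}_p^\times$ (action $g\cdot(v,d)=(gv,\det(g)d)$; the bijection comes from the Deligne–Rapoport description of cusps as $\mathrm{Isom}(\mu_p\times\mathbb{Z}/p\mathbb{Z},(\mathbb{Z}/p\mathbb{Z})^2)/\pm U$, sending $\gamma:(\zeta_p,0)\mapsto(a,b),(1,1)\mapsto(c,d)$ to $((a,b)^T,ad-bc)$), so cusps of $X_H$ correspond to $H\backslash(M_p\times\mathbb{F}_p^\times)$. A cusp of $X_H$ is \emph{at infinity} if it is represented by an element of the form $\left(\begin{pmatrix}a\\0\end{pmatrix},a\right)$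 with $a\in\mathbb{F}_p^\times$. -}

module Defs where

open import Data.Nat as ℕ using (ℕ; zero; suc; NonZero; _≤_)
open import Data.Nat.DivMod using (_mod_)
open import Data.Fin using (Fin; toℕ; fromℕ<)
open import Data.Product using (Σ; ∃; _×_; _,_)
open import Data.Sum using (_⊎_)
open import Data.List using (List; length)
open import Data.List.Membership.Propositional using (_∈_)
open import Data.List.Relation.Unary.Unique.Propositional using (Unique)
open import Relation.Binary.PropositionalEquality using (_≡_; _≢_)
open import Function.Bundles using (_⇔_)

module Fp (p : ℕ) {{nz : NonZero p}} where

  F : Set
  F = Fin p

  0F : F
  0F = 0 mod p

  1F : F
  1F = 1 mod p

  infixl 6 _+F_
  infixl 7 _*F_
  _+F_ : F → F → F
  a +F b = (toℕ a ℕ.+ toℕ b) mod p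

  _*F_ : F → F → F
  a *F b = (toℕ a ℕ.* toℕ b) mod p

  -F_ : F → F
  -F a = (p ℕ.∸ toℕ a) mod p

  _-F_ : F → F → F
  a -F b = a +F (-F b)

  _^F_ : F → ℕ → F
  a ^F zero = 1F
  a ^F suc k = a *F (a ^F k)

  IsGenerator : F → Set
  IsGenerator ε = ε ≢ 0F × (∀ x → x ≢ 0F → ∃ λ k → ε ^F k ≡ x)

  record Mat : Set where
    constructor mat
    field a b c d : F
  open Mat public

  det : Mat → F
  det g = (a g *F d g) -F (b g *F c g)

  infixl 7 _·_
  _·_ : Mat → Mat → Mat
  g · h = mat (a g *F a h +F b g *F c h) (a g *F b h +F b g *F d h)
              (c g *F a h +F d g *F c h) (c g *F b h +F d g *F d h)

  I : Mat
  I = mat 1F 0F 0F 1F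

  record Vec2 : Set where
    constructor vec
    field x y : F
  open Vec2 public

  act : Mat → Vec2 → Vec2
  act g v = vec (a g *F x v +F b g *F y v) (c g *F x v +F d g *F y v)

  neg : Vec2 → Vec2
  neg v = vec (-F x v) (-F y v)

  NonZeroVec : Vec2 → Set
  NonZeroVec v = v ≢ vec 0F 0F

  -- equality in M_p = (F_p^2 ∖ 0)/±1
  _≈M_ : Vec2 → Vec2 → Set
  v ≈M w = (v ≡ w) ⊎ (v ≡ neg w)

  Cns : F → Mat → Set
  Cns ε g = Σ F λ u → Σ F λ v → (vec u v ≢ vec 0F 0F) × (g ≡ mat u (ε *F v) v u)

  Nns : F → Mat → Set
  Nns ε g = Cns ε g ⊎ (Σ Mat λ h → Cns ε h × (g ≡ mat 1F 0F 0F (-F 1F) · h))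

  Nsp : Mat → Set
  Nsp g = det g ≢ 0F × ((b g ≡ 0F × c g ≡ 0F) ⊎ (a g ≡ 0F × d g ≡ 0F))

  record IsSubgroup (H : Mat → Set) : Set where
    field
      inGL  : ∀ g → H g → det g ≢ 0F
      one   : H I
      mul   : ∀ g h → H g → H h → H (g · h)
      inv   : ∀ g → H g → Σ Mat λ h → H h × (g · h ≡ I)

  HasCard : (Mat → Set) → ℕ → Set
  HasCard P n = Σ (List Mat) λ xs → Unique xs × (length xs ≡ n) × (∀ g → (g ∈ xs) ⇔ P g)

  HasIndex : (K H : Mat → Set) → ℕ → Set
  HasIndex K H idx = Σ ℕ λ nK → Σ ℕ λ nH → HasCard K nK × HasCard H nH × (nK ≡ idx ℕ.* nH)

  -- elements of M_p × F_p^×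
  CuspRep : Set
  CuspRep = Vec2 × F

  ValidCuspRep : CuspRep → Set
  ValidCuspRep (v , e) = NonZeroVec v × e ≢ 0F

  SameCusp : (Mat → Set) → CuspRep → CuspRep → Set
  SameCusp H (v , e) (w , f) = Σ Mat λ h → H h × (act h v ≈M w) × (det h *F e ≡ f)

  AtInfinity : (Mat → Set) → CuspRep → Set
  AtInfinity H r = Σ F λ t → t ≢ 0F × SameCusp H r (vec t 0F , t)

-- Since [N_ns : H] ≥ 2, some g ∈ N_ns lies outside H; as τ = diag(1,−1) lies in N_ns ∩ N_sp ⊆ H,
-- we may take g = (u εv; v u) ∈ C_ns. The cusp ((u,v), 1) is not at infinity: if h ∈ H maps (u,v)
-- to ±(t,0), write h = c or h = τc with c ∈ C_ns ∩ H; then c·g ∈ C_ns has first column (±t, 0),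
-- so it is a nonzero scalar matrix, which lies in N_ns ∩ N_sp ⊆ H, and hence g = c⁻¹(c·g) ∈ H.
{-# OPTIONS --safe #-}
module Submission where

open import Defs
open import Data.Nat as ℕ using (ℕ; zero; suc; NonZero; _≤_; nonTrivial⇒n>1)
open import Data.Nat.DivMod using (_mod_; m%n<n; m<n⇒m%n≡m)
import Data.Nat.Properties as ℕ
open import Data.Nat.Divisibility as ℕ using (m%n≡0⇒n∣m)
open import Data.Nat.Primality using (Prime; prime⇒nonTrivial; euclidsLemma)
open import Data.Integer using (ℤ; +_; _+_; _*_; _-_; -_; ∣_∣; _⊖_; _/ℕ_; _%ℕ_)
import Data.Integer.Properties as ℤ
open import Data.Integer.DivMod using (n%ℕd<d; a≡a%ℕn+[a/ℕn]*n)
open import Data.Integer.Divisibility.Signed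
  using (_∣_; divides; ∣m∣n⇒∣m+n; ∣m⇒∣-m; ∣m⇒∣m*n; ∣n⇒∣m*n; ∣⇒∣ᵤ)
open import Data.Integer.Tactic.RingSolver using (solve-∀)
import Data.Integer.Tactic.RingSolver as ℤ-Ring
open import Data.Fin using (Fin; zero; suc; toℕ; fromℕ<; _≟_)
open import Data.Fin.Properties using (toℕ-fromℕ<; toℕ-injective; toℕ<n; injective⇒≤)
open import Data.Vec using (Vec; map)
open import Data.Vec.Properties using (lookup-map)
open import Data.List as List using (List; length)
import Data.List.Relation.Unary.All as All
open import Data.List.Relation.Unary.All using (all?)
open import Data.List.Relation.Unary.All.Properties using (¬All⇒Any¬)
import Data.List.Relation.Unary.Any as Any
open import Data.List.Relation.Unary.AllPairs using (_∷_)
open import Data.List.Relation.Unary.Unique.Propositional using (Unique)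
open import Data.List.Relation.Binary.Subset.Propositional using (_⊆_)
open import Data.List.Membership.Propositional using (_∈_; _∉_; find)
open import Data.List.Membership.Propositional.Properties using (∈-lookup)
open import Data.List.Membership.Setoid.Properties using (index-injective; ∈-length)
import Data.List.Membership.DecPropositional as Membership
open import Data.Product using (Σ; ∃; ∃₂; _×_; _,_)
open import Data.Sum using (inj₁; inj₂; [_,_]′)
open import Data.Empty using (⊥-elim)
open import Function using (_∘_; id)
open import Function.Bundles using (Equivalence)
open import Algebra.Bundles using (RawRing)
open import Tactic.RingSolver.Core.Expression using (Expr; Κ; Ι; _⊕_; _⊗_; _⊛_; ⊝_; module Eval)
import Tactic.RingSolver.NonReflective as NonReflective
import Relation.Binary.Reflection as Reflection
open import Relation.Binary.Definitions using (DecidableEquality)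
open import Relation.Binary.PropositionalEquality
open import Relation.Nullary using (¬_; yes; no)
open import Relation.Nullary.Decidable using (map′; _×-dec_)

multiple<⇒≡0 : ∀ {m n} → m ℕ.∣ n → n ℕ.< m → n ≡ 0
multiple<⇒≡0 {n = zero}  _   _   = refl
multiple<⇒≡0 {n = suc n} m∣n n<m = ⊥-elim (ℕ.<⇒≱ n<m (ℕ.∣⇒≤ m∣n))

module _ {A : Set} where

  lookup-injective : ∀ {xs : List A} → Unique xs → ∀ {i j} → List.lookup xs i ≡ List.lookup xs j → i ≡ j
  lookup-injective (_ ∷ _)          {zero}  {zero}  _     = refl
  lookup-injective (x∉xs ∷ _)       {zero}  {suc j} x≡xⱼ  = ⊥-elim (All.lookup x∉xs (∈-lookup j) x≡xⱼ)
  lookup-injective (x∉xs ∷ _)       {suc i} {zero}  xᵢ≡x  = ⊥-elim (All.lookup x∉xs (∈-lookup i) (sym xᵢ≡x))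
  lookup-injective (_ ∷ unique-xs)  {suc i} {suc j} xᵢ≡xⱼ = cong suc (lookup-injective unique-xs xᵢ≡xⱼ)

  length-mono-⊆ : ∀ {xs ys : List A} → Unique xs → xs ⊆ ys → length xs ℕ.≤ length ys
  length-mono-⊆ {xs} {ys} unique-xs xs⊆ys = injective⇒≤ position-injective
    where
      position : Fin (length xs) → Fin (length ys)
      position i = Any.index (xs⊆ys (∈-lookup i))
      position-injective : ∀ {i j} → position i ≡ position j → i ≡ j
      position-injective {i} {j} eq =
        lookup-injective unique-xs (index-injective (setoid A) (xs⊆ys (∈-lookup i)) (xs⊆ys (∈-lookup j)) eq)

  module _ (_≟_ : DecidableEquality A) where
    open Membership _≟_ using (_∈?_)

    ∃-∉-longer : ∀ {xs ys : List A} → Unique xs → length ys ℕ.< length xs → ∃ λ x → x ∈ xs × x ∉ ys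
    ∃-∉-longer {xs} {ys} unique-xs ys<xs with all? (_∈? ys) xs
    ... | yes xs⊆ys = ⊥-elim (ℕ.<⇒≱ ys<xs (length-mono-⊆ unique-xs (All.lookup xs⊆ys)))
    ... | no  xs⊈ys = find (¬All⇒Any¬ (_∈? ys) xs xs⊈ys)

module ModularArithmetic (p : ℕ) {{nz : NonZero p}} where
  open Fp p

  infix 4 _≡ₚ_
  record _≡ₚ_ (x y : ℤ) : Set where
    constructor congruent
    field p∣x-y : + p ∣ x - y

  ≡⇒≡ₚ : ∀ {x y} → x ≡ y → x ≡ₚ y
  ≡⇒≡ₚ {x} refl = congruent (divides (+ 0) (ℤ.+-inverseʳ x))

  ≡ₚ-trans : ∀ {x y z} → x ≡ₚ y → y ≡ₚ z → x ≡ₚ z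
  ≡ₚ-trans {x} {y} {z} (congruent x≡y) (congruent y≡z) =
    congruent (subst (+ p ∣_) (split x y z) (∣m∣n⇒∣m+n x≡y y≡z))
    where split : ∀ x y z → (x - y) + (y - z) ≡ x - z
          split = solve-∀

  ≡ₚ-sym : ∀ {x y} → x ≡ₚ y → y ≡ₚ x
  ≡ₚ-sym {x} {y} (congruent x≡y) = congruent (subst (+ p ∣_) (flip x y) (∣m⇒∣-m x≡y))
    where flip : ∀ x y → - (x - y) ≡ y - x
          flip = solve-∀

  +-cong : ∀ {x y u v} → x ≡ₚ y → u ≡ₚ v → x + u ≡ₚ y + v
  +-cong {x} {y} {u} {v} (congruent x≡y) (congruent u≡v) =
    congruent (subst (+ p ∣_) (split x y u v) (∣m∣n⇒∣m+n x≡y u≡v))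
    where split : ∀ x y u v → (x - y) + (u - v) ≡ (x + u) - (y + v)
          split = solve-∀

  *-cong : ∀ {x y u v} → x ≡ₚ y → u ≡ₚ v → x * u ≡ₚ y * v
  *-cong {x} {y} {u} {v} (congruent x≡y) (congruent u≡v) =
    congruent (subst (+ p ∣_) (split x y u v) (∣m∣n⇒∣m+n (∣m⇒∣m*n u x≡y) (∣n⇒∣m*n y u≡v)))
    where split : ∀ x y u v → (x - y) * u + y * (u - v) ≡ x * u - y * v
          split = solve-∀

  neg-cong : ∀ {x y} → x ≡ₚ y → - x ≡ₚ - y
  neg-cong {x} {y} (congruent x≡y) = congruent (subst (+ p ∣_) (split x y) (∣m⇒∣-m x≡y))
    where split : ∀ x y → - (x - y) ≡ - x - - y
          split = solve-∀

  ι : F → ℤ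
  ι a = + toℕ a

  fromℤ : ℤ → F
  fromℤ z = fromℕ< (n%ℕd<d z p)

  ι-fromℤ : ∀ z → ι (fromℤ z) ≡ₚ z
  ι-fromℤ z = congruent (divides (- (z /ℕ p)) (begin
      ι (fromℤ z) - z
        ≡⟨ cong₂ _-_ (cong +_ (toℕ-fromℕ< (n%ℕd<d z p))) (a≡a%ℕn+[a/ℕn]*n z p) ⟩
      + (z %ℕ p) - (+ (z %ℕ p) + (z /ℕ p) * + p)
        ≡⟨ cancel (+ (z %ℕ p)) (z /ℕ p) (+ p) ⟩
      - (z /ℕ p) * + p
        ∎))
    where
      open ≡-Reasoning
      cancel : ∀ r q p → r - (r + q * p) ≡ - q * p
      cancel = solve-∀

  ι-injective : ∀ {a b} → ι a ≡ₚ ι b → a ≡ b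
  ι-injective {a} {b} (congruent a≡b) =
    toℕ-injective (ℤ.+-injective (ℤ.i-j≡0⇒i≡j (ι a) (ι b) (ℤ.∣i∣≡0⇒i≡0 (multiple<⇒≡0 (∣⇒∣ᵤ a≡b) bound))))
    where
      bound : ∣ ι a - ι b ∣ ℕ.< p
      bound = begin-strict
        ∣ ι a - ι b ∣      ≡⟨ cong ∣_∣ (ℤ.m-n≡m⊖n (toℕ a) (toℕ b)) ⟩
        ∣ toℕ a ⊖ toℕ b ∣  ≤⟨ ℤ.∣m⊝n∣≤m⊔n (toℕ a) (toℕ b) ⟩
        toℕ a ℕ.⊔ toℕ b    <⟨ ℕ.⊔-lub (toℕ<n a) (toℕ<n b) ⟩
        p                  ∎
        where open ℕ.≤-Reasoning

  ι-+ : ∀ a b → ι (a +F b) ≡ₚ ι a + ι b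
  ι-+ a b = ≡ₚ-trans (ι-fromℤ (+ (toℕ a ℕ.+ toℕ b))) (≡⇒≡ₚ (ℤ.pos-+ (toℕ a) (toℕ b)))

  ι-* : ∀ a b → ι (a *F b) ≡ₚ ι a * ι b
  ι-* a b = ≡ₚ-trans (ι-fromℤ (+ (toℕ a ℕ.* toℕ b))) (≡⇒≡ₚ (ℤ.pos-* (toℕ a) (toℕ b)))

  ι-neg : ∀ a → ι (-F a) ≡ₚ - ι a
  ι-neg a = ≡ₚ-trans (ι-fromℤ (+ (p ℕ.∸ toℕ a))) (congruent (divides (+ 1) (begin
      + (p ℕ.∸ toℕ a) - - ι a      ≡⟨ cong (λ z → + (p ℕ.∸ toℕ a) + z) (ℤ.neg-involutive (ι a)) ⟩
      + (p ℕ.∸ toℕ a) + ι a        ≡⟨ ℤ.pos-+ (p ℕ.∸ toℕ a) (toℕ a) ⟨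
      + (p ℕ.∸ toℕ a ℕ.+ toℕ a)    ≡⟨ cong +_ (ℕ.m∸n+n≡m (ℕ.<⇒≤ (toℕ<n a))) ⟩
      + p                          ≡⟨ ℤ.*-identityˡ (+ p) ⟨
      + 1 * + p                    ∎)))
    where open ≡-Reasoning

  -- Identities in F are proved by lifting them along ι to ℤ, where the ring solver decides them.
  -- fromℤ (+ n) reduces to n mod p, so the constants Κ (+ 0) and Κ (+ 1) denote 0F and 1F.
  rawRing : RawRing _ _
  rawRing = record
    { Carrier = F ; _≈_ = _≡_ ; _+_ = _+F_ ; _*_ = _*F_ ; -_ = -F_ ; 0# = 0F ; 1# = 1F }

  open Eval rawRing fromℤ renaming (⟦_⟧ to ⟦_⟧F)

  module ℤ-Solver = NonReflective ℤ-Ring.ring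
  open ℤ-Solver.Ops using (⟦_⟧; ⟦_⇓⟧)

  ι-hom : ∀ {n} (e : Expr ℤ n) ρ → ι (⟦ e ⟧F ρ) ≡ₚ ⟦ e ⟧ (map ι ρ)
  ι-hom (Κ z)    ρ = ι-fromℤ z
  ι-hom (Ι i)    ρ = ≡⇒≡ₚ (sym (lookup-map i ι ρ))
  ι-hom (e ⊕ e′) ρ = ≡ₚ-trans (ι-+ (⟦ e ⟧F ρ) (⟦ e′ ⟧F ρ)) (+-cong (ι-hom e ρ) (ι-hom e′ ρ))
  ι-hom (e ⊗ e′) ρ = ≡ₚ-trans (ι-* (⟦ e ⟧F ρ) (⟦ e′ ⟧F ρ)) (*-cong (ι-hom e ρ) (ι-hom e′ ρ))
  ι-hom (⊝ e)    ρ = ≡ₚ-trans (ι-neg (⟦ e ⟧F ρ)) (neg-cong (ι-hom e ρ))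
  ι-hom (e ⊛ k)  ρ = ι-pow k
    where
      ι-pow : ∀ k → ι (⟦ e ⊛ k ⟧F ρ) ≡ₚ ⟦ e ⊛ k ⟧ (map ι ρ)
      ι-pow zero          = ι-fromℤ (+ 1)
      ι-pow (suc zero)    = ι-hom e ρ
      ι-pow (suc (suc k)) = ≡ₚ-trans (ι-* (⟦ e ⊛ suc k ⟧F ρ) (⟦ e ⟧F ρ)) (*-cong (ι-pow (suc k)) (ι-hom e ρ))

  ⟦_⇓⟧F : ∀ {n} → Expr ℤ n → Vec F n → F
  ⟦ e ⇓⟧F ρ = fromℤ (⟦ e ⇓⟧ (map ι ρ))

  ⇓-correct : ∀ {n} (e : Expr ℤ n) ρ → ⟦ e ⇓⟧F ρ ≡ ⟦ e ⟧F ρ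
  ⇓-correct e ρ = ι-injective (≡ₚ-trans (ι-fromℤ _)
    (≡ₚ-trans (≡⇒≡ₚ (ℤ-Solver.Ops.correct e (map ι ρ))) (≡ₚ-sym (ι-hom e ρ))))

  open Reflection (setoid F) Ι ⟦_⟧F ⟦_⇓⟧F ⇓-correct public using (solve; _⊜_)

  -F-involutive : ∀ x → -F (-F x) ≡ x
  -F-involutive = solve 1 (λ x → ⊝ ⊝ x ⊜ x) refl

  -F-0 : -F 0F ≡ 0F
  -F-0 = solve 0 (⊝ Κ (+ 0) ⊜ Κ (+ 0)) refl

  -F≡0⇒≡0 : ∀ {x} → -F x ≡ 0F → x ≡ 0F
  -F≡0⇒≡0 {x} -x≡0 = trans (sym (-F-involutive x)) (trans (cong -F_ -x≡0) -F-0)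


module PrimeField (p : ℕ) {{nz : NonZero p}} (p-prime : Prime p) where
  open Fp p

  toℕ-mod : ∀ n → n ℕ.< p → toℕ (n mod p) ≡ n
  toℕ-mod n n<p = trans (toℕ-fromℕ< (m%n<n n p)) (m<n⇒m%n≡m n<p)

  1<p : 1 ℕ.< p
  1<p = nonTrivial⇒n>1 p {{prime⇒nonTrivial p-prime}}

  toℕ-0F : toℕ 0F ≡ 0
  toℕ-0F = toℕ-mod 0 (ℕ.<-trans ℕ.z<s 1<p)

  1F≢0F : 1F ≢ 0F
  1F≢0F 1≡0 with trans (sym (toℕ-mod 1 1<p)) (trans (cong toℕ 1≡0) toℕ-0F)
  ... | ()

  x*x≡0⇒x≡0 : ∀ x → x *F x ≡ 0F → x ≡ 0F
  x*x≡0⇒x≡0 x x²≡0 = toℕ-injective (trans (multiple<⇒≡0 p∣x (toℕ<n x)) (sym toℕ-0F))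
    where
      p∣x² : p ℕ.∣ toℕ x ℕ.* toℕ x
      p∣x² = m%n≡0⇒n∣m _ p (trans (sym (toℕ-fromℕ< (m%n<n _ p))) (trans (cong toℕ x²≡0) toℕ-0F))
      p∣x : p ℕ.∣ toℕ x
      p∣x = [ id , id ]′ (euclidsLemma (toℕ x) (toℕ x) p-prime p∣x²)

module Matrices (p : ℕ) {{nz : NonZero p}} where
  open Fp p
  open ModularArithmetic p using (solve; _⊜_)

  mat-≡ : ∀ {a₁ b₁ c₁ d₁ a₂ b₂ c₂ d₂} → a₁ ≡ a₂ → b₁ ≡ b₂ → c₁ ≡ c₂ → d₁ ≡ d₂ →
          mat a₁ b₁ c₁ d₁ ≡ mat a₂ b₂ c₂ d₂
  mat-≡ refl refl refl refl = refl

  _≟ᴹ_ : DecidableEquality Mat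
  g ≟ᴹ h = map′ (λ (e₁ , e₂ , e₃ , e₄) → mat-≡ e₁ e₂ e₃ e₄)
                (λ g≡h → cong a g≡h , cong b g≡h , cong c g≡h , cong d g≡h)
                (a g ≟ a h ×-dec b g ≟ b h ×-dec c g ≟ c h ×-dec d g ≟ d h)

  row-mat-col-assoc : ∀ x₁ x₂ y₁₁ y₁₂ y₂₁ y₂₂ z₁ z₂ →
    (x₁ *F y₁₁ +F x₂ *F y₂₁) *F z₁ +F (x₁ *F y₁₂ +F x₂ *F y₂₂) *F z₂ ≡
    x₁ *F (y₁₁ *F z₁ +F y₁₂ *F z₂) +F x₂ *F (y₂₁ *F z₁ +F y₂₂ *F z₂)
  row-mat-col-assoc = solve 8 (λ x₁ x₂ y₁₁ y₁₂ y₂₁ y₂₂ z₁ z₂ →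
    (x₁ ⊗ y₁₁ ⊕ x₂ ⊗ y₂₁) ⊗ z₁ ⊕ (x₁ ⊗ y₁₂ ⊕ x₂ ⊗ y₂₂) ⊗ z₂ ⊜
    x₁ ⊗ (y₁₁ ⊗ z₁ ⊕ y₁₂ ⊗ z₂) ⊕ x₂ ⊗ (y₂₁ ⊗ z₁ ⊕ y₂₂ ⊗ z₂)) refl

  ·-assoc : ∀ g h k → (g · h) · k ≡ g · (h · k)
  ·-assoc (mat a₁ b₁ c₁ d₁) (mat a₂ b₂ c₂ d₂) (mat a₃ b₃ c₃ d₃) = mat-≡
    (row-mat-col-assoc a₁ b₁ a₂ b₂ c₂ d₂ a₃ c₃) (row-mat-col-assoc a₁ b₁ a₂ b₂ c₂ d₂ b₃ d₃)
    (row-mat-col-assoc c₁ d₁ a₂ b₂ c₂ d₂ a₃ c₃) (row-mat-col-assoc c₁ d₁ a₂ b₂ c₂ d₂ b₃ d₃)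

  act-· : ∀ g h v → act (g · h) v ≡ act g (act h v)
  act-· (mat a₁ b₁ c₁ d₁) (mat a₂ b₂ c₂ d₂) (vec x y) = cong₂ vec
    (row-mat-col-assoc a₁ b₁ a₂ b₂ c₂ d₂ x y) (row-mat-col-assoc c₁ d₁ a₂ b₂ c₂ d₂ x y)

  ·-identityˡ : ∀ g → I · g ≡ g
  ·-identityˡ (mat a b c d) = mat-≡ (1x+0y≡x a c) (1x+0y≡x b d) (0x+1y≡y a c) (0x+1y≡y b d)
    where
      1x+0y≡x : ∀ x y → 1F *F x +F 0F *F y ≡ x
      1x+0y≡x = solve 2 (λ x y → Κ (+ 1) ⊗ x ⊕ Κ (+ 0) ⊗ y ⊜ x) refl
      0x+1y≡y : ∀ x y → 0F *F x +F 1F *F y ≡ y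
      0x+1y≡y = solve 2 (λ x y → Κ (+ 0) ⊗ x ⊕ Κ (+ 1) ⊗ y ⊜ y) refl

  ·-identityʳ : ∀ g → g · I ≡ g
  ·-identityʳ (mat a b c d) = mat-≡ (x1+y0≡x a b) (x0+y1≡y a b) (x1+y0≡x c d) (x0+y1≡y c d)
    where
      x1+y0≡x : ∀ x y → x *F 1F +F y *F 0F ≡ x
      x1+y0≡x = solve 2 (λ x y → x ⊗ Κ (+ 1) ⊕ y ⊗ Κ (+ 0) ⊜ x) refl
      x0+y1≡y : ∀ x y → x *F 0F +F y *F 1F ≡ y
      x0+y1≡y = solve 2 (λ x y → x ⊗ Κ (+ 0) ⊕ y ⊗ Κ (+ 1) ⊜ y) refl

  right-inverse⇒left-inverse : ∀ {g g′ g″} → g · g′ ≡ I → g′ · g″ ≡ I → g′ · g ≡ I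
  right-inverse⇒left-inverse {g} {g′} {g″} gg′≡I g′g″≡I = trans (cong (g′ ·_) g≡g″) g′g″≡I
    where
      open ≡-Reasoning
      g≡g″ : g ≡ g″
      g≡g″ = begin
        g               ≡⟨ ·-identityʳ g ⟨
        g · I           ≡⟨ cong (g ·_) g′g″≡I ⟨
        g · (g′ · g″)   ≡⟨ ·-assoc g g′ g″ ⟨
        (g · g′) · g″   ≡⟨ cong (_· g″) gg′≡I ⟩
        I · g″          ≡⟨ ·-identityˡ g″ ⟩
        g″              ∎

  ∈-cancelˡ : ∀ {H} → IsSubgroup H → ∀ {g h} → H g → H (g · h) → H h
  ∈-cancelˡ {H} sg {g} {h} Hg Hgh with IsSubgroup.inv sg g Hg
  ... | g′ , Hg′ , gg′≡I with IsSubgroup.inv sg g′ Hg′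
  ... | g″ , _ , g′g″≡I = subst H g′[gh]≡h (IsSubgroup.mul sg g′ (g · h) Hg′ Hgh)
    where
      open ≡-Reasoning
      g′[gh]≡h : g′ · (g · h) ≡ h
      g′[gh]≡h = begin
        g′ · (g · h)   ≡⟨ ·-assoc g′ g h ⟨
        (g′ · g) · h   ≡⟨ cong (_· h) (right-inverse⇒left-inverse {g} {g′} {g″} gg′≡I g′g″≡I) ⟩
        I · h          ≡⟨ ·-identityˡ h ⟩
        h              ∎

module Counting (p : ℕ) {{nz : NonZero p}} where
  open Fp p
  open Matrices p using (_≟ᴹ_)

  ∃-outside-smaller : ∀ {K H m n} → HasCard K m → HasCard H n → n ℕ.< m → Σ Mat λ g → K g × ¬ H g
  ∃-outside-smaller (xs , unique-xs , refl , xs⇔K) (ys , _ , refl , ys⇔H) n<m =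
    let g , g∈xs , g∉ys = ∃-∉-longer _≟ᴹ_ unique-xs n<m
    in g , Equivalence.to (xs⇔K g) g∈xs , g∉ys ∘ Equivalence.from (ys⇔H g)

  ∃-outside-index : ∀ {K H d} → HasIndex K H d → 2 ℕ.≤ d → H I → Σ Mat λ g → K g × ¬ H g
  ∃-outside-index {d = d} (m , n , K-card , H-card@(ys , _ , refl , ys⇔H) , m≡dn) 2≤d H-I =
    ∃-outside-smaller K-card H-card (begin-strict
      n             <⟨ ℕ.m<m+n n (∈-length (setoid Mat) (Equivalence.from (ys⇔H I) H-I)) ⟩
      n ℕ.+ n       ≡⟨ cong (n ℕ.+_) (ℕ.+-identityʳ n) ⟨
      2 ℕ.* n       ≤⟨ ℕ.*-monoˡ-≤ n 2≤d ⟩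
      d ℕ.* n       ≡⟨ m≡dn ⟨
      m             ∎)
    where open ℕ.≤-Reasoning

module NonSplitCartan (p : ℕ) {{nz : NonZero p}} (p-prime : Prime p) (ε : Fp.F p) where
  open Fp p
  open ModularArithmetic p using (solve; _⊜_; -F-0; -F≡0⇒≡0)
  open PrimeField p p-prime
  open Matrices p

  cartan : F → F → Mat
  cartan u v = mat u (ε *F v) v u

  τ : Mat
  τ = mat 1F 0F 0F (-F 1F)

  ε*0≡0 : ε *F 0F ≡ 0F
  ε*0≡0 = solve 1 (λ e → e ⊗ Κ (+ 0) ⊜ Κ (+ 0)) refl ε

  cartan-· : ∀ s w u v → cartan s w · cartan u v ≡ cartan (s *F u +F (ε *F w) *F v) (w *F u +F s *F v)
  cartan-· s w u v = mat-≡ refl (b-entry s w u v ε) refl (d-entry s w u v ε)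
    where
      b-entry : ∀ s w u v e → s *F (e *F v) +F (e *F w) *F u ≡ e *F (w *F u +F s *F v)
      b-entry = solve 5 (λ s w u v e → s ⊗ (e ⊗ v) ⊕ (e ⊗ w) ⊗ u ⊜ e ⊗ (w ⊗ u ⊕ s ⊗ v)) refl
      d-entry : ∀ s w u v e → w *F (e *F v) +F s *F u ≡ s *F u +F (e *F w) *F v
      d-entry = solve 5 (λ s w u v e → w ⊗ (e ⊗ v) ⊕ s ⊗ u ⊜ s ⊗ u ⊕ (e ⊗ w) ⊗ v) refl

  det-cartan-x0 : ∀ x → det (cartan x 0F) ≡ x *F x
  det-cartan-x0 x = solve 2 (λ x e → x ⊗ x ⊕ ⊝ ((e ⊗ Κ (+ 0)) ⊗ Κ (+ 0)) ⊜ x ⊗ x) refl x ε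

  det-τ : det τ ≡ -F 1F
  det-τ = solve 0 (Κ (+ 1) ⊗ ⊝ Κ (+ 1) ⊕ ⊝ (Κ (+ 0) ⊗ Κ (+ 0)) ⊜ ⊝ Κ (+ 1)) refl

  act-τ : ∀ x y → act τ (vec x y) ≡ vec x (-F y)
  act-τ x y = cong₂ vec (solve 2 (λ x y → Κ (+ 1) ⊗ x ⊕ Κ (+ 0) ⊗ y ⊜ x) refl x y)
                        (solve 2 (λ x y → Κ (+ 0) ⊗ x ⊕ ⊝ Κ (+ 1) ⊗ y ⊜ ⊝ y) refl x y)

  OnXAxis : Vec2 → Set
  OnXAxis v = x v ≢ 0F × y v ≡ 0F

  ≈M-onXAxis : ∀ {t v} → t ≢ 0F → v ≈M vec t 0F → OnXAxis v
  ≈M-onXAxis t≢0 (inj₁ refl) = t≢0 , refl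
  ≈M-onXAxis t≢0 (inj₂ refl) = t≢0 ∘ -F≡0⇒≡0 , -F-0

  onXAxis-τ : ∀ v → OnXAxis (act τ v) → OnXAxis v
  -- A with or rewrite on act-τ here makes Agda normalise act τ v and run out of memory.
  onXAxis-τ (vec x y) onAxis =
    let x≢0 , -y≡0 = subst OnXAxis (act-τ x y) onAxis in x≢0 , -F≡0⇒≡0 {y} -y≡0

  module IntermediateSubgroup (H : Mat → Set) (sg : IsSubgroup H) (H⊆Nns : ∀ g → H g → Nns ε g)
                              (Nns∩Nsp⊆H : ∀ g → Nns ε g → Nsp g → H g) where
    open IsSubgroup sg

    cartan-x0∈H : ∀ {x} → x ≢ 0F → H (cartan x 0F)
    cartan-x0∈H {x} x≢0 = Nns∩Nsp⊆H _ (inj₁ (x , 0F , x≢0 ∘ cong Vec2.x , refl))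
      (x≢0 ∘ x*x≡0⇒x≡0 x ∘ trans (sym (det-cartan-x0 x)) , inj₁ (ε*0≡0 , refl))

    τ∈H : H τ
    τ∈H = Nns∩Nsp⊆H τ (inj₂ (cartan 1F 0F , (1F , 0F , 1F≢0F ∘ cong Vec2.x , refl) , τ≡τ·cartan-10))
      (1F≢0F ∘ -F≡0⇒≡0 ∘ trans (sym det-τ) , inj₁ (refl , refl))
      where
        τ≡τ·cartan-10 : τ ≡ τ · cartan 1F 0F
        τ≡τ·cartan-10 = sym (trans (cong (λ z → τ · mat 1F z 0F 1F) ε*0≡0) (·-identityʳ τ))

    cartan∈H : ∀ {s w u v} → H (cartan s w) → OnXAxis (act (cartan s w) (vec u v)) → H (cartan u v)
    cartan∈H {s} {w} {u} {v} H-sw (X≢0 , Y≡0) =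
      ∈-cancelˡ sg H-sw (subst H (sym (trans (cartan-· s w u v) (cong (cartan _) Y≡0))) (cartan-x0∈H X≢0))

    cartan∉H⇒¬AtInfinity : ∀ {u v} → ¬ H (cartan u v) → ¬ AtInfinity H (vec u v , 1F)
    cartan∉H⇒¬AtInfinity {u} {v} ∉H (t , t≢0 , h , H-h , hv≈te₁ , _) with H⊆Nns h H-h
    ... | inj₁ (s , w , _ , refl) = ∉H (cartan∈H H-h (≈M-onXAxis t≢0 hv≈te₁))
    ... | inj₂ (_ , (s , w , _ , refl) , refl) = ∉H (cartan∈H (∈-cancelˡ sg τ∈H H-h)
      (onXAxis-τ _ (subst OnXAxis (act-· τ (cartan s w) (vec u v)) (≈M-onXAxis t≢0 hv≈te₁))))

    ∃-cartan∉H : (Σ Mat λ g → Nns ε g × ¬ H g) → ∃₂ λ u v → vec u v ≢ vec 0F 0F × ¬ H (cartan u v)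
    ∃-cartan∉H (_ , inj₁ (u , v , uv≢0 , refl) , ∉H) = u , v , uv≢0 , ∉H
    ∃-cartan∉H (_ , inj₂ (_ , (s , w , sw≢0 , refl) , refl) , ∉H) = s , w , sw≢0 , ∉H ∘ mul τ (cartan s w) τ∈H


lemma3p2 : (p : ℕ) {{nz : NonZero p}} → Prime p → p ≢ 2 →
    let open Fp p in
    (ε : F) → IsGenerator ε →
    (H : Mat → Set) → IsSubgroup H → (∀ g → H g → Nns ε g) →
    (∀ g → Nns ε g → Nsp g → H g) →
    (d : ℕ) → 2 ≤ d → HasIndex (Nns ε) H d →
    Σ CuspRep λ r → ValidCuspRep r × ¬ AtInfinity H r
lemma3p2 p p-prime _ ε _ H sg H⊆Nns Nns∩Nsp⊆H d 2≤d index =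
  let u , v , uv≢0 , ∉H = ∃-cartan∉H (∃-outside-index index 2≤d (IsSubgroup.one sg))
  in (vec u v , 1F) , (uv≢0 , 1F≢0F) , cartan∉H⇒¬AtInfinity ∉H
  where
    open Fp p
    open PrimeField p p-prime using (1F≢0F)
    open Counting p using (∃-outside-index)
    open NonSplitCartan p p-prime ε
    open IntermediateSubgroup H sg H⊆Nns Nns∩Nsp⊆H
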